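{- Let $(v,k)$ be a pair of positive integers with $v>3$ satisfying $(2v-5)^2-2(2k-3)^2+1=0$. Then $\binom k2\le\frac12\binom v2<\binom{k+1}2$; that is, $k=k_0(v)$.
   Context: $k_0(v)$ denotes the unique integer with $\binom{k_0}2\le\frac12\binom v2<\binom{k_0+1}2$. -}

module Defs where

module Submission where

-- For positive integers v, k the Pell-type equation
--   (2v-5)² - 2(2k-3)² + 1 = 0                                   (★)
-- is, after expanding and dividing by 4, the natural-number equation
--   v² + 6k + 2 = 2k² + 5v.
-- Using 2·C(n,2) + n = n², this reads in binomial form
--   2·C(k,2) + 2v = C(v,2) + 2k + 1,
-- i.e. C(v,2) = 2·C(k,2) + 2(v - k) - 1.  Hence the two claimed inequalities
--   2·C(k,2) ≤ C(v,2)   and   C(v,2) < 2·C(k+1,2) = 2·C(k,2) + 2k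
-- are equivalent to  k < v  and  v ≤ 2k  respectively.  Both bounds follow from
-- the quadratic equation itself: if v ≤ k (with v ≥ 4), or if v > 2k (with
-- k ≥ 1, v ≥ 4), then one side of the equation exceeds the other by an
-- explicit positive polynomial.

open import Defs
open import Data.Nat using (ℕ; suc; zero; s≤s; _<_; _≤_; _≰_; _≮_; _*_; _+_)
open import Data.Nat.Properties
open import Data.Nat.Combinatorics using (_C_; nC1≡n; nCk+nC[k+1]≡[n+1]C[k+1])
open import Data.Integer using (ℤ; +_) renaming (_*_ to _*ℤ_; _+_ to _+ℤ_; _-_ to _-ℤ_)
import Data.Integer.Properties as ℤP
open import Data.Product using (_×_; _,_)
open import Relation.Binary.PropositionalEquality
open import Relation.Nullary using (¬_)
open import Data.Nat.Tactic.RingSolver using (solve-∀)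
import Data.Integer.Tactic.RingSolver as ℤSolver

PellEquation : ℕ → ℕ → Set
PellEquation v k = v * v + 6 * k + 2 ≡ 2 * (k * k) + 5 * v

pell-expansion : ∀ (V K : ℤ) →
  (+ 2 *ℤ V -ℤ + 5) *ℤ (+ 2 *ℤ V -ℤ + 5)
    -ℤ + 2 *ℤ ((+ 2 *ℤ K -ℤ + 3) *ℤ (+ 2 *ℤ K -ℤ + 3)) +ℤ + 1
  ≡ + 4 *ℤ ((V *ℤ V +ℤ + 6 *ℤ K +ℤ + 2) -ℤ (+ 2 *ℤ (K *ℤ K) +ℤ + 5 *ℤ V))
pell-expansion = ℤSolver.solve-∀

pell-lhs-embedding : ∀ v k →
  + (v * v + 6 * k + 2) ≡ + v *ℤ + v +ℤ + 6 *ℤ + k +ℤ + 2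
pell-lhs-embedding v k =
  trans (ℤP.pos-+ (v * v + 6 * k) 2)
        (cong (_+ℤ + 2) (trans (ℤP.pos-+ (v * v) (6 * k))
                               (cong₂ _+ℤ_ (ℤP.pos-* v v) (ℤP.pos-* 6 k))))

pell-rhs-embedding : ∀ v k →
  + (2 * (k * k) + 5 * v) ≡ + 2 *ℤ (+ k *ℤ + k) +ℤ + 5 *ℤ + v
pell-rhs-embedding v k =
  trans (ℤP.pos-+ (2 * (k * k)) (5 * v))
        (cong₂ _+ℤ_ (trans (ℤP.pos-* 2 (k * k)) (cong (+ 2 *ℤ_) (ℤP.pos-* k k)))
                    (ℤP.pos-* 5 v))

pell-from-ℤ : ∀ v k →
  (+ (2 * v) -ℤ + 5) *ℤ (+ (2 * v) -ℤ + 5)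
    -ℤ + 2 *ℤ ((+ (2 * k) -ℤ + 3) *ℤ (+ (2 * k) -ℤ + 3)) +ℤ + 1 ≡ + 0 →
  PellEquation v k
pell-from-ℤ v k eq = ℤP.+-injective sides-equal
  where
  open ≡-Reasoning
  lhs rhs : ℤ
  lhs = + v *ℤ + v +ℤ + 6 *ℤ + k +ℤ + 2
  rhs = + 2 *ℤ (+ k *ℤ + k) +ℤ + 5 *ℤ + v
  four-times-difference : + 4 *ℤ (lhs -ℤ rhs) ≡ + 4 *ℤ + 0
  four-times-difference = begin
    + 4 *ℤ (lhs -ℤ rhs)
      ≡⟨ sym (pell-expansion (+ v) (+ k)) ⟩
    (+ 2 *ℤ + v -ℤ + 5) *ℤ (+ 2 *ℤ + v -ℤ + 5)
      -ℤ + 2 *ℤ ((+ 2 *ℤ + k -ℤ + 3) *ℤ (+ 2 *ℤ + k -ℤ + 3)) +ℤ + 1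
      ≡⟨ cong₂ (λ V K → (V -ℤ + 5) *ℤ (V -ℤ + 5)
                          -ℤ + 2 *ℤ ((K -ℤ + 3) *ℤ (K -ℤ + 3)) +ℤ + 1)
               (sym (ℤP.pos-* 2 v)) (sym (ℤP.pos-* 2 k)) ⟩
    (+ (2 * v) -ℤ + 5) *ℤ (+ (2 * v) -ℤ + 5)
      -ℤ + 2 *ℤ ((+ (2 * k) -ℤ + 3) *ℤ (+ (2 * k) -ℤ + 3)) +ℤ + 1
      ≡⟨ eq ⟩
    + 0 ∎
  sides-equal : + (v * v + 6 * k + 2) ≡ + (2 * (k * k) + 5 * v)
  sides-equal = begin
    + (v * v + 6 * k + 2)     ≡⟨ pell-lhs-embedding v k ⟩
    lhs                       ≡⟨ ℤP.i-j≡0⇒i≡j lhs rhs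
                                   (ℤP.*-cancelˡ-≡ (+ 4) (lhs -ℤ rhs) (+ 0) four-times-difference) ⟩
    rhs                       ≡⟨ sym (pell-rhs-embedding v k) ⟩
    + (2 * (k * k) + 5 * v)   ∎

suc-choose-2 : ∀ n → suc n C 2 ≡ n + n C 2
suc-choose-2 n =
  trans (sym (nCk+nC[k+1]≡[n+1]C[k+1] n 1)) (cong (_+ n C 2) (nC1≡n n))

twice-choose-2 : ∀ n → 2 * (n C 2) + n ≡ n * n
twice-choose-2 zero    = refl
twice-choose-2 (suc n) = begin
  2 * (suc n C 2) + suc n      ≡⟨ cong (λ c → 2 * c + suc n) (suc-choose-2 n) ⟩
  2 * (n + n C 2) + suc n      ≡⟨ regroup n (n C 2) ⟩
  (2 * (n C 2) + n) + (2 * n + 1) ≡⟨ cong (_+ (2 * n + 1)) (twice-choose-2 n) ⟩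
  n * n + (2 * n + 1)          ≡⟨ square-suc n ⟩
  suc n * suc n                ∎
  where
  open ≡-Reasoning
  regroup : ∀ n c → 2 * (n + c) + suc n ≡ (2 * c + n) + (2 * n + 1)
  regroup = solve-∀
  square-suc : ∀ n → n * n + (2 * n + 1) ≡ suc n * suc n
  square-suc = solve-∀

pell-binomial : ∀ {v k} → PellEquation v k →
  2 * (k C 2) + 2 * v ≡ v C 2 + suc (2 * k)
pell-binomial {v} {k} eq =
  *-cancelˡ-≡ _ _ 2 (+-cancelʳ-≡ (v + 2 * k) _ _ doubled)
  where
  open ≡-Reasoning
  X = k C 2
  Y = v C 2
  expand-rhs : ∀ X v k → 2 * (2 * X + 2 * v) + (v + 2 * k) ≡ 2 * (2 * X + k) + 5 * v
  expand-rhs = solve-∀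
  expand-lhs : ∀ Y v k → (2 * Y + v) + 6 * k + 2 ≡ 2 * (Y + suc (2 * k)) + (v + 2 * k)
  expand-lhs = solve-∀
  doubled : 2 * (2 * X + 2 * v) + (v + 2 * k) ≡ 2 * (Y + suc (2 * k)) + (v + 2 * k)
  doubled = begin
    2 * (2 * X + 2 * v) + (v + 2 * k) ≡⟨ expand-rhs X v k ⟩
    2 * (2 * X + k) + 5 * v           ≡⟨ cong (λ s → 2 * s + 5 * v) (twice-choose-2 k) ⟩
    2 * (k * k) + 5 * v               ≡⟨ sym eq ⟩
    v * v + 6 * k + 2                 ≡⟨ cong (λ s → s + 6 * k + 2) (sym (twice-choose-2 v)) ⟩
    (2 * Y + v) + 6 * k + 2           ≡⟨ expand-lhs Y v k ⟩
    2 * (Y + suc (2 * k)) + (v + 2 * k) ∎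

no-solution-with-k≥v : ∀ a d → ¬ PellEquation (4 + a) (4 + a + d)
no-solution-with-k≥v a d eq = m+1+n≢m _ (trans (sym (excess a d)) (sym eq))
  where
  excess : ∀ a d → 2 * ((4 + a + d) * (4 + a + d)) + 5 * (4 + a)
    ≡ ((4 + a) * (4 + a) + 6 * (4 + a + d) + 2)
      + suc (a * a + 2 * (d * d) + 4 * a * d + 7 * a + 10 * d + 9)
  excess = solve-∀

-- There is no solution with v > 2k other than (v, k) = (3, 1): writing
-- k = 1 + g and v = 2k + 1 + f, the left-hand side exceeds the right-hand side
-- by 2g² + 4g + 4gf + f² + f, which vanishes only for g = f = 0.
no-solution-with-v>2k : ∀ g f → 3 < suc (2 * suc g) + f →
  ¬ PellEquation (suc (2 * suc g) + f) (suc g)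
no-solution-with-v>2k zero zero (s≤s (s≤s (s≤s ())))
no-solution-with-v>2k zero (suc f) _ eq = m+1+n≢m _ (trans (sym (excess f)) eq)
  where
  excess : ∀ f → (3 + suc f) * (3 + suc f) + 6 * 1 + 2
    ≡ (2 * (1 * 1) + 5 * (3 + suc f)) + suc (1 + f * f + 3 * f)
  excess = solve-∀
no-solution-with-v>2k (suc g) f _ eq = m+1+n≢m _ (trans (sym (excess g f)) eq)
  where
  excess : ∀ g f →
    (suc (2 * suc (suc g)) + f) * (suc (2 * suc (suc g)) + f) + 6 * suc (suc g) + 2
    ≡ (2 * (suc (suc g) * suc (suc g)) + 5 * (suc (2 * suc (suc g)) + f))
      + suc (5 + 2 * (g * g) + 8 * g + f * f + 5 * f + 4 * g * f)
  excess = solve-∀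

pell-lower-bound : ∀ {v k} → 3 < v → PellEquation v k → k < v
pell-lower-bound {v} {k} 3<v eq = ≰⇒> v≰k
  where
  v≰k : v ≰ k
  v≰k v≤k with m≤n⇒∃[o]m+o≡n 3<v | m≤n⇒∃[o]m+o≡n v≤k
  ... | a , refl | d , refl = no-solution-with-k≥v a d eq

pell-upper-bound : ∀ {v k} → 0 < k → 3 < v → PellEquation v k → v ≤ 2 * k
pell-upper-bound {v} {suc g} _ 3<v eq = ≮⇒≥ 2k≮v
  where
  2k≮v : 2 * suc g ≮ v
  2k≮v 2k<v with m≤n⇒∃[o]m+o≡n 2k<v
  ... | f , refl = no-solution-with-v>2k g f 3<v eq

binomial-lower : ∀ X Y v k → 2 * X + 2 * v ≡ Y + suc (2 * k) → k < v → 2 * X ≤ Y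
binomial-lower X Y v k form k<v = +-cancelʳ-≤ (2 * v) (2 * X) Y (begin
  2 * X + 2 * v     ≡⟨ form ⟩
  Y + suc (2 * k)   ≤⟨ +-monoʳ-≤ Y (*-monoʳ-< 2 k<v) ⟩
  Y + 2 * v         ∎)
  where open ≤-Reasoning

binomial-upper : ∀ X Y v k → 2 * X + 2 * v ≡ Y + suc (2 * k) → v ≤ 2 * k → Y < 2 * (k + X)
binomial-upper X Y v k form v≤2k = +-cancelʳ-≤ (2 * k) (suc Y) (2 * (k + X)) (begin
  suc Y + 2 * k         ≡⟨ sym (+-suc Y (2 * k)) ⟩
  Y + suc (2 * k)       ≡⟨ sym form ⟩
  2 * X + 2 * v         ≤⟨ +-monoʳ-≤ (2 * X) (*-monoʳ-≤ 2 v≤2k) ⟩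
  2 * X + 2 * (2 * k)   ≡⟨ regroup X k ⟩
  2 * (k + X) + 2 * k   ∎)
  where
  open ≤-Reasoning
  regroup : ∀ X k → 2 * X + 2 * (2 * k) ≡ 2 * (k + X) + 2 * k
  regroup = solve-∀

lemma17 : (v k : ℕ) → 0 < v → 0 < k → 3 < v →
    ((+ (2 * v) -ℤ + 5) *ℤ (+ (2 * v) -ℤ + 5)
      -ℤ + 2 *ℤ ((+ (2 * k) -ℤ + 3) *ℤ (+ (2 * k) -ℤ + 3)) +ℤ + 1 ≡ + 0) →
    (2 * (k C 2) ≤ v C 2) × (v C 2 < 2 * (suc k C 2))
lemma17 v k _ 0<k 3<v pellℤ =
    binomial-lower (k C 2) (v C 2) v k form (pell-lower-bound 3<v pell)
  , subst (λ c → v C 2 < 2 * c) (sym (suc-choose-2 k))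
      (binomial-upper (k C 2) (v C 2) v k form (pell-upper-bound 0<k 3<v pell))
  where
  pell : PellEquation v k
  pell = pell-from-ℤ v k pellℤ
  form : 2 * (k C 2) + 2 * v ≡ v C 2 + suc (2 * k)
  form = pell-binomial {v} {k} pell
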